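{- Let $\mathcal{G},\mathcal{H}$ be finite nonempty sequences of rooted connected clique-cactus graphs. If $\mathcal{H}\le^\star\mathcal{G}$, then $\mathrm{cycle}(\mathcal{H})\le\mathrm{cycle}(\mathcal{G})$, $\mathrm{clique}(\mathcal{H})\le\mathrm{clique}(\mathcal{G})$, and $\mathrm{stick}(\mathcal{H})\le\mathrm{stick}(\mathcal{G})$, where $\le$ denotes rooted contraction.
   Context: Graphs are finite, simple. A rooted graph is a graph $G$ with a distinguished vertex $\mathrm{rt}(G)$. A contraction model of $H$ in $G$ is a map $\varphi\colon V(H)\to 2^{V(G)}$ whose images induce connected subgraphs, partition $V(G)$, and such that $u,v$ are adjacent in $H$ iff $\varphi(u),\varphi(v)$ are joined by an edge of $G$. For rooted graphs, $H\le G$ (rooted contraction) if there is such a model with $\mathrm{rt}(G)\in\varphi(\mathrm{rt}(H))$. A clique-cactus graph is a graph whose blocks are cycles or complete graphs; let $\mathcal{C}$ be the class of rooted connected clique-cactus graphs (same graph with different roots counted as different). For a sequence $\langle G_0,\dots,G_{p-1}\rangle$ ($p\ge1$) of graphs of $\mathcal{C}$, let $U$ be the disjoint union of $G_0,\dots,G_{p-1}$; $\mathrm{stick}(G_0,\dots,G_{p-1})$ is obtained from $U$ by identifying $\mathrm{rt}(G_0),\dots,\mathrm{rt}(G_{p-1})$; $\mathrm{cycle}(G_0,\dots,G_{p-1})$ is obtained from $U$ by adding the edges $\{\mathrm{rt}(G_i),\mathrm{rt}(G_{(i+1)\bmod p})\}$ for $i\in\{0,\dots,p-1\}$; $\mathrm{clique}(G_0,\dots,G_{p-1})$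 is obtained from $U$ by adding all edges $\{\mathrm{rt}(G_i),\mathrm{rt}(G_j)\}$ for distinct $i,j$ (graphs stay simple: no loops or parallel edges are created). In each case the root is the vertex $\mathrm{rt}(G_0)$. For sequences $r=\langle r_1,\dots,r_p\rangle$, $s=\langle s_1,\dots,s_q\rangle$ of rooted graphs, $r\le^\star s$ if there is a strictly increasing function $\psi\colon\{1,\dots,p\}\to\{1,\dots,q\}$ with $r_i\le s_{\psi(i)}$ for all $i$. -}

module Defs where

open import Data.Nat using (ℕ; zero; suc; _+_; _<_; _%_)
open import Data.Fin using (Fin) renaming (_<_ to _<ᶠ_)
import Data.Fin as F
open import Data.Product using (Σ; ∃; _×_; _,_; proj₁; proj₂)
open import Data.Sum using (_⊎_; inj₁; inj₂)
open import Data.Unit using (⊤; tt)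
open import Data.Empty using (⊥; ⊥-elim)
open import Data.Bool.Properties using (T-irrelevant)
open import Data.List using (List)
open import Data.List.Membership.Propositional using (_∈_)
open import Relation.Nullary using (¬_; yes; no)
open import Relation.Nullary.Decidable using (False; fromWitnessFalse)
open import Relation.Binary.Definitions using (DecidableEquality)
open import Relation.Binary.PropositionalEquality using (_≡_; _≢_; refl; sym; trans; cong)
open import Function.Definitions using (Injective)
open import Function.Bundles using (_⇔_)
import Data.Product.Properties as ΣP
import Data.Sum.Properties as ⊎P

-- Simple graphs: a vertex type with decidable equality and a symmetric,
-- irreflexive adjacency relation.  (Finiteness is imposed separately,
-- in the class 𝒞 below.)

record Graph : Set₁ where
  field
    V       : Set
    _≟V_    : DecidableEquality V
    E       : V → V → Set
    E-sym   : ∀ {x y} → E x y → E y x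
    E-irrefl : ∀ {x} → ¬ E x x
open Graph public

record RGraph : Set₁ where
  constructor rooted
  field
    graph : Graph
    rt    : V graph
open RGraph public

Finite : Graph → Set
Finite G = Σ (List (V G)) λ xs → ∀ x → x ∈ xs

data Walk (G : Graph) (P : V G → Set) : V G → V G → Set where
  stop : ∀ {x} → P x → Walk G P x x
  step : ∀ {x y z} → P x → E G x y → Walk G P y z → Walk G P x z

ConnectedOn : (G : Graph) → (V G → Set) → Set
ConnectedOn G S = Σ (V G) S × (∀ x y → S x → S y → Walk G S x y)

Connected : Graph → Set
Connected G = ConnectedOn G (λ _ → ⊤)

ConnNoCut : (G : Graph) → (V G → Set) → Set
ConnNoCut G S =
  ConnectedOn G S ×
  (∀ v → S v → ∀ x y → S x → S y → x ≢ v → y ≢ v →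
     Walk G (λ z → S z × z ≢ v) x y)

IsBlock : (G : Graph) → (V G → Set) → Set₁
IsBlock G B =
  ConnNoCut G B ×
  (∀ (T : V G → Set) → (∀ x → B x → T x) → ConnNoCut G T → ∀ x → T x → B x)

Consecutive : (n : ℕ) → Fin (suc n) → Fin (suc n) → Set
Consecutive n i j =
  F.toℕ j ≡ suc (F.toℕ i) % suc n ⊎ F.toℕ i ≡ suc (F.toℕ j) % suc n

-- G[B] is a cycle: isomorphic to C_k for some k = 3 + m ≥ 3.
IsCycleOn : (G : Graph) → (V G → Set) → Set
IsCycleOn G B =
  Σ ℕ λ m → Σ (Fin (3 + m) → V G) λ f →
    Injective _≡_ _≡_ f ×
    (∀ x → B x ⇔ (∃ λ i → f i ≡ x)) ×
    (∀ i j → E G (f i) (f j) ⇔ Consecutive (2 + m) i j)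

IsCompleteOn : (G : Graph) → (V G → Set) → Set
IsCompleteOn G B = ∀ x y → B x → B y → x ≢ y → E G x y

CliqueCactus : Graph → Set₁
CliqueCactus G = ∀ (B : V G → Set) → IsBlock G B → IsCycleOn G B ⊎ IsCompleteOn G B

InC : RGraph → Set₁
InC H = Finite (graph H) × Connected (graph H) × CliqueCactus (graph H)

record Model (H G : RGraph) : Set₁ where
  private
    module H = Graph (graph H)
    module G = Graph (graph G)
  field
    φ     : H.V → G.V → Set
    conn  : ∀ u → ConnectedOn (graph G) (φ u)
    cover : ∀ x → Σ H.V λ u → φ u x
    disj  : ∀ u v x → φ u x → φ v x → u ≡ v
    adj   : ∀ u v → u ≢ v →
            H.E u v ⇔ (Σ G.V λ x → Σ G.V λ y → φ u x × φ v y × G.E x y)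
    root  : φ (rt H) (rt G)

_≤R_ : RGraph → RGraph → Set₁
H ≤R G = Model H G

-- Sequences (nonempty): Fin (suc p) → RGraph, indices 0 … p.

module _ {p : ℕ} (Gs : Fin (suc p) → RGraph) where
  private
    Vi : Fin (suc p) → Set
    Vi i = V (graph (Gs i))
    Ei : ∀ i → Vi i → Vi i → Set
    Ei i = E (graph (Gs i))
    ri : ∀ i → Vi i
    ri i = rt (Gs i)

  UV : Set
  UV = Σ (Fin (suc p)) Vi

  UV-dec : DecidableEquality UV
  UV-dec = ΣP.≡-dec F._≟_ (λ {i} → _≟V_ (graph (Gs i)))

  data CycE : UV → UV → Set where
    inner : ∀ {i x y} → Ei i x y → CycE (i , x) (i , y)
    link  : ∀ {i j x y} → x ≡ ri i → y ≡ ri j → i ≢ j → Consecutive p i j →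
            CycE (i , x) (j , y)

  CycE-sym : ∀ {a b} → CycE a b → CycE b a
  CycE-sym (inner {i} e) = inner (E-sym (graph (Gs i)) e)
  CycE-sym (link px py n (inj₁ c)) = link py px (λ q → n (sym q)) (inj₂ c)
  CycE-sym (link px py n (inj₂ c)) = link py px (λ q → n (sym q)) (inj₁ c)

  CycE-irrefl : ∀ {a} → ¬ CycE a a
  CycE-irrefl (inner {i} e) = E-irrefl (graph (Gs i)) e
  CycE-irrefl (link _ _ n _) = n refl

  cycleG : RGraph
  cycleG = rooted (record { V = UV ; _≟V_ = UV-dec ; E = CycE
                          ; E-sym = CycE-sym ; E-irrefl = CycE-irrefl })
                  (F.zero , ri F.zero)

  data CliE : UV → UV → Set where
    inner : ∀ {i x y} → Ei i x y → CliE (i , x) (i , y)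
    link  : ∀ {i j x y} → x ≡ ri i → y ≡ ri j → i ≢ j → CliE (i , x) (j , y)

  CliE-sym : ∀ {a b} → CliE a b → CliE b a
  CliE-sym (inner {i} e) = inner (E-sym (graph (Gs i)) e)
  CliE-sym (link px py n) = link py px (λ q → n (sym q))

  CliE-irrefl : ∀ {a} → ¬ CliE a a
  CliE-irrefl (inner {i} e) = E-irrefl (graph (Gs i)) e
  CliE-irrefl (link _ _ n) = n refl

  cliqueG : RGraph
  cliqueG = rooted (record { V = UV ; _≟V_ = UV-dec ; E = CliE
                           ; E-sym = CliE-sym ; E-irrefl = CliE-irrefl })
                   (F.zero , ri F.zero)

  -- stick(Gs): all roots identified into one vertex (inj₁ tt); every
  -- other vertex is a non-root vertex of some component.
  SV : Set
  SV = ⊤ ⊎ Σ (Fin (suc p)) λ i → Σ (Vi i) λ x → False (_≟V_ (graph (Gs i)) x (ri i))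

  SV-dec : DecidableEquality SV
  SV-dec = ⊎P.≡-dec (λ { tt tt → yes refl })
    (ΣP.≡-dec F._≟_ (λ {i} → ΣP.≡-dec (_≟V_ (graph (Gs i)))
                                 (λ a b → yes (T-irrelevant a b))))

  emb : ∀ i → Vi i → SV
  emb i x with _≟V_ (graph (Gs i)) x (ri i)
  ... | yes _ = inj₁ tt
  ... | no ¬q = inj₂ (i , x , fromWitnessFalse ¬q)

  emb-inj : ∀ i {x y} → emb i x ≡ emb i y → x ≡ y
  emb-inj i {x} {y} eq with _≟V_ (graph (Gs i)) x (ri i) | _≟V_ (graph (Gs i)) y (ri i)
  emb-inj i eq | yes px | yes py = trans px (sym py)
  emb-inj i () | yes _ | no _
  emb-inj i () | no _ | yes _
  emb-inj i refl | no _ | no _ = refl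

  StE : SV → SV → Set
  StE a b = Σ (Fin (suc p)) λ i → Σ (Vi i) λ x → Σ (Vi i) λ y →
              Ei i x y × emb i x ≡ a × emb i y ≡ b

  StE-sym : ∀ {a b} → StE a b → StE b a
  StE-sym (i , x , y , e , p₁ , p₂) = i , y , x , E-sym (graph (Gs i)) e , p₂ , p₁

  StE-irrefl : ∀ {a} → ¬ StE a a
  StE-irrefl (i , x , y , e , refl , q) with emb-inj i q
  ... | refl = E-irrefl (graph (Gs i)) e

  stickG : RGraph
  stickG = rooted (record { V = SV ; _≟V_ = SV-dec ; E = StE
                          ; E-sym = StE-sym ; E-irrefl = StE-irrefl })
                  (inj₁ tt)

_≤⋆_ : ∀ {p q} → (Fin (suc p) → RGraph) → (Fin (suc q) → RGraph) → Set₁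
_≤⋆_ {p} {q} r s =
  Σ (Fin (suc p) → Fin (suc q)) λ ψ →
    (∀ i j → i <ᶠ j → ψ i <ᶠ ψ j) × (∀ i → r i ≤R s (ψ i))

module Submission where

-- Let ψ witness Hs ≤⋆ Gs.  Each component G_(ψ i) carries a contraction model of H_i, and every
-- other component G_j is contracted wholesale into the root of the H_i to which j is assigned.
-- The assignment is a contraction of the index graph of Gs onto that of Hs (a cycle or a
-- complete graph on the indices, linked through the roots), and such a contraction of the
-- indices lifts to the linked unions.  For the clique any retraction of ψ fixing 0 works; for the cycle,
-- j goes to the least i with j ≤ ψ i (the last index if there is none), so that the fibres are
-- arcs.  The stick is the clique with all roots identified, and the clique model descends to it
-- because it places roots of Gs only in bags of roots of Hs.

open import Defs
open import Data.Nat using (ℕ; zero; suc; _+_; _∸_; _≤_; _<_; _%_; z≤n; s≤s; s≤s⁻¹; _≟_; _≤?_; _<?_)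
open import Data.Nat.Properties
  using (≤-refl; ≤-reflexive; ≤-antisym; <⇒≤; <⇒≱; ≮⇒≥; ≰⇒>; ≤∧≢⇒<; <-cmp; <-trans; <-≤-trans; n<1+n; m<n⇒m<1+n;
         m≤n⇒m<n∨m≡n; 1+n≢n; m≤n+m; +-suc; m∸n+n≡m)
open import Data.Nat.DivMod using (m<n⇒m%n≡m; n%n≡0)
open import Data.Fin using (Fin; toℕ; fromℕ; fromℕ<)
import Data.Fin as F
open import Data.Fin.Properties
  using (toℕ-injective; toℕ-fromℕ; toℕ-fromℕ<; toℕ≤pred[n]; toℕ<n; toℕ-inject; all?; ¬∀⟶∃¬-smallest)
open import Data.Product using (Σ; _×_; _,_; proj₁; proj₂)
open import Data.Sum using (_⊎_; inj₁; inj₂; swap)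
open import Data.Sum.Properties using (inj₂-injective)
open import Data.Unit using (tt; ⊤)
open import Data.Empty using (⊥-elim)
open import Function using (_∘_; id; case_of_)
open import Function.Bundles using (_⇔_; mk⇔; Equivalence)
open import Relation.Nullary using (¬_; yes; no; Dec)
open import Relation.Nullary.Decidable using (False; toWitnessFalse)
open import Data.Bool.Properties using (T-irrelevant)
open import Relation.Binary.Definitions using (tri<; tri≈; tri>)
open import Relation.Binary.PropositionalEquality
  using (_≡_; _≢_; refl; sym; trans; cong; subst; subst₂)

module _ {G : Graph} {P : V G → Set} where

  source∈ : ∀ {x y} → Walk G P x y → P x
  source∈ (stop px) = px
  source∈ (step px _ _) = px

  _++ʷ_ : ∀ {x y z} → Walk G P x y → Walk G P y z → Walk G P x z
  stop _ ++ʷ w = w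
  step px e w ++ʷ w' = step px e (w ++ʷ w')

  reverseʷ : ∀ {x y} → Walk G P x y → Walk G P y x
  reverseʷ (stop px) = stop px
  reverseʷ (step px e w) = reverseʷ w ++ʷ step (source∈ w) (E-sym G e) (stop px)

  connectedOn-hub : ∀ c → P c → (∀ x → P x → Walk G P x c) → ConnectedOn G P
  connectedOn-hub c pc to-c = (c , pc) , λ x y px py → to-c x px ++ʷ reverseʷ (to-c y py)

mapʷ : ∀ {G G' : Graph} {P : V G → Set} {Q : V G' → Set} (f : V G → V G') →
  (∀ {x} → P x → Q (f x)) → (∀ {x y} → E G x y → E G' (f x) (f y) ⊎ f x ≡ f y) →
  ∀ {x z} → Walk G P x z → Walk G' Q (f x) (f z)
mapʷ f P⇒Q E⇒E (stop px) = stop (P⇒Q px)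
mapʷ {G' = G'} {Q = Q} f P⇒Q E⇒E {z = z} (step px e w) with E⇒E e
... | inj₁ e' = step (P⇒Q px) e' (mapʷ f P⇒Q E⇒E w)
... | inj₂ fx≡fy = subst (λ c → Walk G' Q c (f z)) (sym fx≡fy) (mapʷ f P⇒Q E⇒E w)

module _ {H G : RGraph}
  {EH : V (graph H) → V (graph H) → Set} {EH-sym : ∀ {x y} → EH x y → EH y x} {EH-irrefl : ∀ {x} → ¬ EH x x}
  {EG : V (graph G) → V (graph G) → Set} {EG-sym : ∀ {x y} → EG x y → EG y x} {EG-irrefl : ∀ {x} → ¬ EG x x}
  where

  ≤R-resp-edge⇔ : H ≤R G →
    (∀ {x y} → E (graph H) x y ⇔ EH x y) → (∀ {x y} → E (graph G) x y ⇔ EG x y) →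
    rooted (record (graph H) { E = EH ; E-sym = EH-sym ; E-irrefl = EH-irrefl }) (rt H) ≤R
    rooted (record (graph G) { E = EG ; E-sym = EG-sym ; E-irrefl = EG-irrefl }) (rt G)
  ≤R-resp-edge⇔ M H⇔ G⇔ = record
    { φ = Model.φ M
    ; conn = λ u → proj₁ (Model.conn M u) , λ x y px py →
        mapʷ id id (inj₁ ∘ Equivalence.to G⇔) (proj₂ (Model.conn M u) x y px py)
    ; cover = Model.cover M
    ; disj = Model.disj M
    ; adj = λ u v u≢v → mk⇔
        (λ e → let (x , y , fx , fy , e') = Equivalence.to (Model.adj M u v u≢v) (Equivalence.from H⇔ e)
               in x , y , fx , fy , Equivalence.to G⇔ e')
        (λ (x , y , fx , fy , e') →
           Equivalence.to H⇔ (Equivalence.from (Model.adj M u v u≢v) (x , y , fx , fy , Equivalence.from G⇔ e')))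
    ; root = Model.root M
    }

indexGraph : ∀ {n} (L : Fin (suc n) → Fin (suc n) → Set) → (∀ {i j} → L i j → L j i) → RGraph
indexGraph {n} L L-sym = rooted (record
  { V = Fin (suc n) ; _≟V_ = F._≟_ ; E = λ i j → i ≢ j × L i j
  ; E-sym = λ (i≢j , l) → i≢j ∘ sym , L-sym l ; E-irrefl = λ (i≢i , _) → i≢i refl }) F.zero

module _ {n : ℕ} (Gs : Fin (suc n) → RGraph) where

  data LinkE (L : Fin (suc n) → Fin (suc n) → Set) : UV Gs → UV Gs → Set where
    inner : ∀ {i x y} → E (graph (Gs i)) x y → LinkE L (i , x) (i , y)
    link  : ∀ {i j} → i ≢ j → L i j → LinkE L (i , rt (Gs i)) (j , rt (Gs j))

  IsRoot : UV Gs → Set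
  IsRoot (j , y) = y ≡ rt (Gs j)

  isRoot? : ∀ a → Dec (IsRoot a)
  isRoot? (j , y) = _≟V_ (graph (Gs j)) y (rt (Gs j))

  quot : UV Gs → SV Gs
  quot (j , y) = emb Gs j y

module _ {n : ℕ} (L : Fin (suc n) → Fin (suc n) → Set) (L-sym : ∀ {i j} → L i j → L j i)
         (Gs : Fin (suc n) → RGraph) where

  linked : RGraph
  linked = rooted (record
    { V = UV Gs ; _≟V_ = UV-dec Gs ; E = LinkE Gs L ; E-sym = LinkE-sym ; E-irrefl = LinkE-irrefl })
    (F.zero , rt (Gs F.zero))
    where
      LinkE-sym : ∀ {a b} → LinkE Gs L a b → LinkE Gs L b a
      LinkE-sym (inner {i} e) = inner (E-sym (graph (Gs i)) e)
      LinkE-sym (link i≢j l) = link (i≢j ∘ sym) (L-sym l)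

      LinkE-irrefl : ∀ {a} → ¬ LinkE Gs L a a
      LinkE-irrefl (inner {i} e) = E-irrefl (graph (Gs i)) e
      LinkE-irrefl (link i≢i _) = i≢i refl

module Lift {p q : ℕ}
  {LH : Fin (suc p) → Fin (suc p) → Set} (LH-sym : ∀ {i i'} → LH i i' → LH i' i)
  {LG : Fin (suc q) → Fin (suc q) → Set} (LG-sym : ∀ {j j'} → LG j j' → LG j' j)
  (I : indexGraph LH LH-sym ≤R indexGraph LG LG-sym)
  {Hs : Fin (suc p) → RGraph} {Gs : Fin (suc q) → RGraph}
  (ψ : Fin (suc p) → Fin (suc q)) (ψ∈ : ∀ i → Model.φ I i (ψ i))
  (Ms : ∀ i → Hs i ≤R Gs (ψ i)) (Gs-conn : ∀ j → Connected (graph (Gs j)))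
  where

  private
    B : Fin (suc p) → Fin (suc q) → Set
    B = Model.φ I

    φ : ∀ i → V (graph (Hs i)) → V (graph (Gs (ψ i))) → Set
    φ i = Model.φ (Ms i)

    LinkedG : Graph
    LinkedG = graph (linked LG LG-sym Gs)

  data Bag : UV Hs → UV Gs → Set where
    here   : ∀ {i x g} y → φ i x y → (ψ i , y) ≡ g → Bag (i , x) g
    spread : ∀ {i j y} → B i j → j ≢ ψ i → Bag (i , rt (Hs i)) (j , y)

  bag-index : ∀ {u g} → Bag u g → B (proj₁ u) (proj₁ g)
  bag-index (here _ _ refl) = ψ∈ _
  bag-index (spread b _) = b

  bag-index-unique : ∀ {u v j y y'} → Bag u (j , y) → Bag v (j , y') → proj₁ u ≡ proj₁ v
  bag-index-unique b b' = Model.disj I _ _ _ (bag-index b) (bag-index b')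

  root-bag : ∀ {i j} → B i j → Bag (i , rt (Hs i)) (j , rt (Gs j))
  root-bag {i} {j} b with j F.≟ ψ i
  ... | yes refl = here _ (Model.root (Ms i)) refl
  ... | no j≢ψi = spread b j≢ψi

  root-only : ∀ {u g} → Bag u g → IsRoot Gs g → IsRoot Hs u
  root-only (here {i} _ f refl) refl = Model.disj (Ms i) _ _ _ f (Model.root (Ms i))
  root-only (spread _ _) _ = refl

  centre : ∀ i x → V (graph (Gs (ψ i)))
  centre i x = proj₁ (proj₁ (Model.conn (Ms i) x))

  centre∈ : ∀ i x → φ i x (centre i x)
  centre∈ i x = proj₂ (proj₁ (Model.conn (Ms i) x))

  within-component : ∀ i x {y y'} → φ i x y → φ i x y' → Walk LinkedG (Bag (i , x)) (ψ i , y) (ψ i , y')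
  within-component i x f f' =
    mapʷ (ψ i ,_) (λ f'' → here _ f'' refl) (inj₁ ∘ inner) (proj₂ (Model.conn (Ms i) x) _ _ f f')

  to-centre : ∀ {i x g} → Bag (i , x) g → Walk LinkedG (Bag (i , x)) g (ψ i , centre i x)
  to-centre {i} {x} (here y f refl) = within-component i x f (centre∈ i x)
  to-centre {i} (spread {j = j} {y} b j≢ψi) =
    mapʷ (j ,_) (λ _ → spread b j≢ψi) (inj₁ ∘ inner) (proj₂ (Gs-conn j) y (rt (Gs j)) tt tt)
    ++ʷ (mapʷ (λ k → k , rt (Gs k)) root-bag (λ (k≢k' , l) → inj₁ (link k≢k' l))
           (proj₂ (Model.conn I i) j (ψ i) b (ψ∈ i))
    ++ʷ within-component i (rt (Hs i)) (Model.root (Ms i)) (centre∈ i (rt (Hs i))))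

  cover : ∀ g → Σ (UV Hs) λ u → Bag u g
  cover (j , y) with Model.cover I j
  ... | i , b with j F.≟ ψ i
  ...   | yes refl = (i , proj₁ (Model.cover (Ms i) y)) , here y (proj₂ (Model.cover (Ms i) y)) refl
  ...   | no j≢ψi = (i , rt (Hs i)) , spread b j≢ψi

  same-vertex : ∀ {i x x' g} → Bag (i , x) g → Bag (i , x') g → x ≡ x'
  same-vertex {i} (here y f refl) (here y' f' refl) = Model.disj (Ms i) _ _ y f f'
  same-vertex (here _ _ refl) (spread _ ψi≢ψi) = ⊥-elim (ψi≢ψi refl)
  same-vertex (spread _ j≢ψi) (here _ _ refl) = ⊥-elim (j≢ψi refl)
  same-vertex (spread _ _) (spread _ _) = refl

  disj : ∀ u v g → Bag u g → Bag v g → u ≡ v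
  disj (i , x) (i' , x') (j , y) b b' with bag-index-unique b b'
  ... | refl = cong (i ,_) (same-vertex b b')

  lift-edge : ∀ {u v} → u ≢ v → LinkE Hs LH u v →
    Σ (UV Gs) λ g → Σ (UV Gs) λ g' → Bag u g × Bag v g' × LinkE Gs LG g g'
  lift-edge u≢v (inner {i} {x} {x'} e)
    with Equivalence.to (Model.adj (Ms i) x x' (u≢v ∘ cong (i ,_))) e
  ... | y , y' , f , f' , e' = (ψ i , y) , (ψ i , y') , here y f refl , here y' f' refl , inner e'
  lift-edge _ (link i≢i' l) with Equivalence.to (Model.adj I _ _ i≢i') (i≢i' , l)
  ... | j , j' , b , b' , j≢j' , l' =
    (j , rt (Gs j)) , (j' , rt (Gs j')) , root-bag b , root-bag b' , link j≢j' l'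

  project-inner : ∀ {i x x' j y y'} → x ≢ x' → Bag (i , x) (j , y) → Bag (i , x') (j , y') →
    E (graph (Gs j)) y y' → E (graph (Hs i)) x x'
  project-inner {i} x≢x' (here _ f refl) (here _ f' refl) e =
    Equivalence.from (Model.adj (Ms i) _ _ x≢x') (_ , _ , f , f' , e)
  project-inner _ (here _ _ refl) (spread _ ψi≢ψi) _ = ⊥-elim (ψi≢ψi refl)
  project-inner _ (spread _ j≢ψi) (here _ _ refl) _ = ⊥-elim (j≢ψi refl)
  project-inner rt≢rt (spread _ _) (spread _ _) _ = ⊥-elim (rt≢rt refl)

  project-edge : ∀ {u v g g'} → u ≢ v → Bag u g → Bag v g' → LinkE Gs LG g g' → LinkE Hs LH u v
  project-edge {i , x} {i' , x'} u≢v b b' (inner e) with bag-index-unique b b'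
  ... | refl = inner (project-inner (u≢v ∘ cong (i ,_)) b b' e)
  project-edge {i , x} {i' , x'} u≢v b b' (link j≢j' l) with root-only b refl | root-only b' refl
  ... | refl | refl = link i≢i' (proj₂ (Equivalence.from (Model.adj I i i' i≢i')
                                       (_ , _ , bag-index b , bag-index b' , j≢j' , l)))
    where
      i≢i' : i ≢ i'
      i≢i' = u≢v ∘ cong (λ k → k , rt (Hs k))

  linked-≤R : linked LH LH-sym Hs ≤R linked LG LG-sym Gs
  linked-≤R = record
    { φ = Bag
    ; conn = λ (i , x) → connectedOn-hub (ψ i , centre i x) (here _ (centre∈ i x) refl) (λ _ → to-centre)
    ; cover = cover
    ; disj = disj
    ; adj = λ u v u≢v → mk⇔ (lift-edge u≢v) (λ (_ , _ , b , b' , e) → project-edge u≢v b b' e)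
    ; root = root-bag (Model.root I)
    }

module _ {p q : ℕ}
  {LH : Fin (suc p) → Fin (suc p) → Set} (LH-sym : ∀ {i i'} → LH i i' → LH i' i)
  {LG : Fin (suc q) → Fin (suc q) → Set} (LG-sym : ∀ {j j'} → LG j j' → LG j' j)
  (ψ : Fin (suc p) → Fin (suc q)) (d : Fin (suc q) → Fin (suc p))
  (d∘ψ : ∀ i → d (ψ i) ≡ i) (d-zero : d F.zero ≡ F.zero)
  (fibre-walk : ∀ {i j} → d j ≡ i → Walk (graph (indexGraph LG LG-sym)) (λ k → d k ≡ i) j (ψ i))
  (lift-link : ∀ {i i'} → LH i i' → Σ (Fin (suc q)) λ j → Σ (Fin (suc q)) λ j' →
                 d j ≡ i × d j' ≡ i' × LG j j')
  (project-link : ∀ {j j'} → d j ≢ d j' → LG j j' → LH (d j) (d j'))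
  where

  fibres-≤R : indexGraph LH LH-sym ≤R indexGraph LG LG-sym
  fibres-≤R = record
    { φ = λ i j → d j ≡ i
    ; conn = λ i → connectedOn-hub (ψ i) (d∘ψ i) (λ _ → fibre-walk)
    ; cover = λ j → d j , refl
    ; disj = λ _ _ _ dj≡i dj≡i' → trans (sym dj≡i) dj≡i'
    ; adj = λ i i' i≢i' → mk⇔
        (λ (_ , l) → let (j , j' , dj≡i , dj'≡i' , l') = lift-link l in
           j , j' , dj≡i , dj'≡i' , (λ j≡j' → i≢i' (trans (sym dj≡i) (trans (cong d j≡j') dj'≡i'))) , l')
        (λ (_ , _ , dj≡i , dj'≡i' , _ , l') →
           i≢i' , subst₂ LH dj≡i dj'≡i' (project-link (λ dj≡dj' → i≢i' (trans (sym dj≡i) (trans dj≡dj' dj'≡i'))) l'))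
    ; root = d-zero
    }

Complete : ∀ {n} → Fin n → Fin n → Set
Complete _ _ = ⊤

clique-index-≤R : ∀ {p q} (ψ : Fin (suc p) → Fin (suc q)) (d : Fin (suc q) → Fin (suc p)) →
  (∀ i → d (ψ i) ≡ i) → d F.zero ≡ F.zero →
  indexGraph Complete (λ _ → tt) ≤R indexGraph Complete (λ _ → tt)
clique-index-≤R ψ d d∘ψ d-zero =
  fibres-≤R _ _ ψ d d∘ψ d-zero fibre-walk (λ {i} {i'} _ → ψ i , ψ i' , d∘ψ i , d∘ψ i' , tt) (λ _ _ → tt)
  where
    fibre-walk : ∀ {i j} → d j ≡ i → Walk (graph (indexGraph Complete (λ _ → tt))) (λ k → d k ≡ i) j (ψ i)
    fibre-walk {i} {j} dj≡i with j F.≟ ψ i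
    ... | yes refl = stop dj≡i
    ... | no j≢ψi = step dj≡i (j≢ψi , tt) (stop (d∘ψ i))

consecutive-sym : ∀ {n} {k k' : Fin (suc n)} → Consecutive n k k' → Consecutive n k' k
consecutive-sym = swap

consecutive-suc : ∀ {n} {k k' : Fin (suc n)} → toℕ k' ≡ suc (toℕ k) → Consecutive n k k'
consecutive-suc {n} {k} {k'} k'≡1+k =
  inj₁ (trans k'≡1+k (sym (m<n⇒m%n≡m (subst (_< suc n) k'≡1+k (toℕ<n k')))))

consecutive-wrap : ∀ {n} {k k' : Fin (suc n)} → toℕ k ≡ n → toℕ k' ≡ 0 → Consecutive n k k'
consecutive-wrap {n} k≡n k'≡0 =
  inj₁ (trans k'≡0 (sym (trans (cong (λ m → suc m % suc n) k≡n) (n%n≡0 (suc n)))))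

suc-mod-view : ∀ {n} {k k' : Fin (suc n)} → toℕ k' ≡ suc (toℕ k) % suc n →
  toℕ k' ≡ suc (toℕ k) ⊎ (toℕ k ≡ n × toℕ k' ≡ 0)
suc-mod-view {n} {k} k'≡ with toℕ k <? n
... | yes k<n = inj₁ (trans k'≡ (m<n⇒m%n≡m (s≤s k<n)))
... | no k≮n = inj₂ (k≡n , trans k'≡ (trans (cong (λ m → suc m % suc n) k≡n) (n%n≡0 (suc n))))
  where
    k≡n : toℕ k ≡ n
    k≡n = ≤-antisym (toℕ≤pred[n] k) (≮⇒≥ k≮n)

module Owner {p q : ℕ} (ψ : Fin (suc p) → Fin (suc q))
  (ψ-strict : ∀ i i' → toℕ i < toℕ i' → toℕ (ψ i) < toℕ (ψ i')) where

  ψ-monotone : ∀ {k i} → toℕ k ≤ toℕ i → toℕ (ψ k) ≤ toℕ (ψ i)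
  ψ-monotone {k} {i} k≤i with m≤n⇒m<n∨m≡n k≤i
  ... | inj₁ k<i = <⇒≤ (ψ-strict k i k<i)
  ... | inj₂ k≡i = ≤-reflexive (cong (toℕ ∘ ψ) (toℕ-injective k≡i))

  -- The owner of j is the least i with j ≤ ψ i, or the last index p if there is none; the
  -- fibres of the owner map are thus arcs of the cycle, the one of i running up to ψ i.
  Owner : Fin (suc q) → Fin (suc p) → Set
  Owner j i = (∀ k → toℕ k < toℕ i → toℕ (ψ k) < toℕ j) × (toℕ j ≤ toℕ (ψ i) ⊎ toℕ i ≡ p)

  owner-≮ : ∀ {j i i'} → Owner j i → Owner j i' → ¬ toℕ i < toℕ i'
  owner-≮ (_ , inj₁ j≤ψi) (below' , _) i<i' = <⇒≱ (below' _ i<i') j≤ψi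
  owner-≮ {i' = i'} (_ , inj₂ i≡p) _ i<i' = <⇒≱ i<i' (subst (toℕ i' ≤_) (sym i≡p) (toℕ≤pred[n] i'))

  owner-unique : ∀ {j i i'} → Owner j i → Owner j i' → i ≡ i'
  owner-unique {i = i} {i'} o o' with <-cmp (toℕ i) (toℕ i')
  ... | tri< i<i' _ _ = ⊥-elim (owner-≮ o o' i<i')
  ... | tri≈ _ i≡i' _ = toℕ-injective i≡i'
  ... | tri> _ _ i'<i = ⊥-elim (owner-≮ o' o i'<i)

  owner-exists : ∀ j → Σ (Fin (suc p)) (Owner j)
  owner-exists j with all? (λ k → toℕ (ψ k) <? toℕ j)
  ... | yes all-below = fromℕ p , (λ k _ → all-below k) , inj₂ (toℕ-fromℕ p)
  ... | no ¬all-below with ¬∀⟶∃¬-smallest _ _ (λ k → toℕ (ψ k) <? toℕ j) ¬all-below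
  ...   | i , ψi≮j , below = i , below′ , inj₁ (≮⇒≥ ψi≮j)
    where
      below′ : ∀ k → toℕ k < toℕ i → toℕ (ψ k) < toℕ j
      below′ k k<i = subst (λ k′ → toℕ (ψ k′) < toℕ j)
        (toℕ-injective (trans (toℕ-inject (fromℕ< k<i)) (toℕ-fromℕ< k<i))) (below (fromℕ< k<i))

  owner : Fin (suc q) → Fin (suc p)
  owner j = proj₁ (owner-exists j)

  owner-spec : ∀ j → Owner j (owner j)
  owner-spec j = proj₂ (owner-exists j)

  owner-≡ : ∀ {j i} → Owner j i → owner j ≡ i
  owner-≡ = owner-unique (owner-spec _)

  owner-ψ : ∀ i → owner (ψ i) ≡ i
  owner-ψ i = owner-≡ ((λ k → ψ-strict k i) , inj₁ ≤-refl)

  owner-zero : owner F.zero ≡ F.zero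
  owner-zero = owner-≡ ((λ _ ()) , inj₁ z≤n)

  Owner-beyond : ∀ {j i} → toℕ i ≡ p → toℕ (ψ i) ≤ toℕ j → Owner j i
  Owner-beyond {i = i} i≡p ψi≤j = (λ k k<i → <-≤-trans (ψ-strict k i k<i) ψi≤j) , inj₂ i≡p

  Owner-after-ψ : ∀ {i i' j'} → toℕ i' ≡ suc (toℕ i) → toℕ j' ≡ suc (toℕ (ψ i)) → Owner j' i'
  Owner-after-ψ {i} {i'} {j'} i'≡1+i j'≡1+ψi = below , inj₁ j'≤ψi'
    where
      below : ∀ k → toℕ k < toℕ i' → toℕ (ψ k) < toℕ j'
      below k k<i' = subst (toℕ (ψ k) <_) (sym j'≡1+ψi)
        (s≤s (ψ-monotone (s≤s⁻¹ (subst (toℕ k <_) i'≡1+i k<i'))))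
      j'≤ψi' : toℕ j' ≤ toℕ (ψ i')
      j'≤ψi' = subst (_≤ toℕ (ψ i')) (sym j'≡1+ψi)
        (ψ-strict i i' (subst (toℕ i <_) (sym i'≡1+i) (n<1+n (toℕ i))))

  Owner-suc-within : ∀ {j j' i} → toℕ j' ≡ suc (toℕ j) → Owner j i →
    toℕ j' ≤ toℕ (ψ i) ⊎ toℕ i ≡ p → Owner j' i
  Owner-suc-within j'≡1+j (below , _) above =
    (λ k k<i → subst (toℕ (ψ k) <_) (sym j'≡1+j) (m<n⇒m<1+n (below k k<i))) , above

  Owner-suc : ∀ {j j' i} → toℕ j' ≡ suc (toℕ j) → Owner j i →
    Owner j' i ⊎ Σ (Fin (suc p)) λ i⁺ → toℕ i⁺ ≡ suc (toℕ i) × Owner j' i⁺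
  Owner-suc {i = i} j'≡1+j o with toℕ i ≟ p
  ... | yes i≡p = inj₁ (Owner-suc-within j'≡1+j o (inj₂ i≡p))
  ... | no i≢p with proj₂ o
  ...   | inj₂ i≡p = ⊥-elim (i≢p i≡p)
  ...   | inj₁ j≤ψi with m≤n⇒m<n∨m≡n j≤ψi
  ...     | inj₁ j<ψi = inj₁ (Owner-suc-within j'≡1+j o (inj₁ (subst (_≤ _) (sym j'≡1+j) j<ψi)))
  ...     | inj₂ j≡ψi =
    inj₂ (fromℕ< i+1≤p , toℕ-fromℕ< i+1≤p , Owner-after-ψ (toℕ-fromℕ< i+1≤p) (trans j'≡1+j (cong suc j≡ψi)))
    where
      i+1≤p : suc (toℕ i) < suc p
      i+1≤p = s≤s (≤∧≢⇒< (toℕ≤pred[n] i) i≢p)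

  CycleIndex : Graph
  CycleIndex = graph (indexGraph (Consecutive q) consecutive-sym)

  succ-edge : ∀ {j j'} → toℕ j' ≡ suc (toℕ j) → E CycleIndex j j'
  succ-edge j'≡1+j = (λ j≡j' → 1+n≢n (sym (trans (cong toℕ j≡j') j'≡1+j))) , consecutive-suc j'≡1+j

  walk-up : ∀ n {i j} → Owner j i → n + toℕ j ≡ toℕ (ψ i) → Walk CycleIndex (λ k → owner k ≡ i) j (ψ i)
  walk-up zero o j≡ψi = subst (Walk CycleIndex _ _) (toℕ-injective j≡ψi) (stop (owner-≡ o))
  walk-up (suc n) {i} {j} o 1+n+j≡ψi = step (owner-≡ o) (succ-edge j'≡1+j) (walk-up n o' n+j'≡ψi)
    where
      j<ψi : toℕ j < toℕ (ψ i)
      j<ψi = subst (toℕ j <_) 1+n+j≡ψi (s≤s (m≤n+m (toℕ j) n))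
      j<q : toℕ j < q
      j<q = <-≤-trans j<ψi (toℕ≤pred[n] (ψ i))
      j' : Fin (suc q)
      j' = fromℕ< (s≤s j<q)
      j'≡1+j : toℕ j' ≡ suc (toℕ j)
      j'≡1+j = toℕ-fromℕ< (s≤s j<q)
      o' : Owner j' i
      o' = Owner-suc-within j'≡1+j o (inj₁ (subst (_≤ toℕ (ψ i)) (sym j'≡1+j) j<ψi))
      n+j'≡ψi : n + toℕ j' ≡ toℕ (ψ i)
      n+j'≡ψi = trans (cong (n +_) j'≡1+j) (trans (+-suc n (toℕ j)) 1+n+j≡ψi)

  walk-down : ∀ n {i j} → toℕ i ≡ p → toℕ j ≡ n + toℕ (ψ i) → Walk CycleIndex (λ k → owner k ≡ i) j (ψ i)
  walk-down zero i≡p j≡ψi =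
    subst (Walk CycleIndex _ _) (toℕ-injective j≡ψi) (stop (owner-≡ (Owner-beyond i≡p (≤-reflexive (sym j≡ψi)))))
  walk-down (suc n) {i} {j} i≡p j≡ =
    step (owner-≡ (Owner-beyond i≡p ψi≤j)) (E-sym CycleIndex (succ-edge j≡1+j⁻)) (walk-down n i≡p j⁻≡)
    where
      ψi≤j : toℕ (ψ i) ≤ toℕ j
      ψi≤j = subst (toℕ (ψ i) ≤_) (sym j≡) (m≤n+m (toℕ (ψ i)) (suc n))
      j⁻<1+q : n + toℕ (ψ i) < suc q
      j⁻<1+q = <-trans (n<1+n _) (subst (_< suc q) j≡ (toℕ<n j))
      j⁻ : Fin (suc q)
      j⁻ = fromℕ< j⁻<1+q
      j⁻≡ : toℕ j⁻ ≡ n + toℕ (ψ i)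
      j⁻≡ = toℕ-fromℕ< j⁻<1+q
      j≡1+j⁻ : toℕ j ≡ suc (toℕ j⁻)
      j≡1+j⁻ = trans j≡ (cong suc (sym j⁻≡))

  fibre-walk : ∀ {i j} → owner j ≡ i → Walk CycleIndex (λ k → owner k ≡ i) j (ψ i)
  fibre-walk {j = j} refl with owner-spec j | toℕ j ≤? toℕ (ψ (owner j))
  ... | o | yes j≤ψi = walk-up (toℕ (ψ (owner j)) ∸ toℕ j) o (m∸n+n≡m j≤ψi)
  ... | _ , inj₁ j≤ψi | no j≰ψi = ⊥-elim (j≰ψi j≤ψi)
  ... | _ , inj₂ i≡p | no j≰ψi =
    walk-down (toℕ j ∸ toℕ (ψ (owner j))) i≡p (sym (m∸n+n≡m (<⇒≤ (≰⇒> j≰ψi))))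

  lift-succ : ∀ {i i'} → toℕ i' ≡ suc (toℕ i) % suc p → Σ (Fin (suc q)) λ j → Σ (Fin (suc q)) λ j' →
    owner j ≡ i × owner j' ≡ i' × Consecutive q j j'
  lift-succ {i} {i'} i'≡ with suc-mod-view i'≡
  ... | inj₁ i'≡1+i = ψ i , j' , owner-ψ i , owner-≡ (Owner-after-ψ i'≡1+i j'≡1+ψi) , consecutive-suc j'≡1+ψi
    where
      ψi<q : toℕ (ψ i) < q
      ψi<q = <-≤-trans (ψ-strict i i' (subst (toℕ i <_) (sym i'≡1+i) (n<1+n (toℕ i)))) (toℕ≤pred[n] (ψ i'))
      j' : Fin (suc q)
      j' = fromℕ< (s≤s ψi<q)
      j'≡1+ψi : toℕ j' ≡ suc (toℕ (ψ i))
      j'≡1+ψi = toℕ-fromℕ< (s≤s ψi<q)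
  ... | inj₂ (i≡p , i'≡0) =
    fromℕ q , F.zero ,
    owner-≡ (Owner-beyond i≡p (subst (toℕ (ψ i) ≤_) (sym (toℕ-fromℕ q)) (toℕ≤pred[n] (ψ i)))) ,
    trans owner-zero (sym (toℕ-injective i'≡0)) ,
    consecutive-wrap (toℕ-fromℕ q) refl

  lift-link : ∀ {i i'} → Consecutive p i i' → Σ (Fin (suc q)) λ j → Σ (Fin (suc q)) λ j' →
    owner j ≡ i × owner j' ≡ i' × Consecutive q j j'
  lift-link (inj₁ i'≡) = lift-succ i'≡
  lift-link (inj₂ i≡) = let (j , j' , dj , dj' , c) = lift-succ i≡ in j' , j , dj' , dj , consecutive-sym c

  project-succ : ∀ {j j'} → owner j ≢ owner j' → toℕ j' ≡ suc (toℕ j) % suc q →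
    Consecutive p (owner j) (owner j')
  project-succ {j} {j'} dj≢dj' j'≡ with suc-mod-view j'≡
  ... | inj₂ (j≡q , j'≡0) = consecutive-wrap dj≡p dj'≡0
    where
      dj≡p : toℕ (owner j) ≡ p
      dj≡p = trans (cong toℕ (owner-≡ (Owner-beyond (toℕ-fromℕ p) (subst (_ ≤_) (sym j≡q) (toℕ≤pred[n] _)))))
                   (toℕ-fromℕ p)
      dj'≡0 : toℕ (owner j') ≡ 0
      dj'≡0 = cong toℕ (trans (cong owner (toℕ-injective {j = F.zero} j'≡0)) owner-zero)
  ... | inj₁ j'≡1+j with Owner-suc j'≡1+j (owner-spec j)
  ...   | inj₁ o' = ⊥-elim (dj≢dj' (sym (owner-≡ o')))
  ...   | inj₂ (_ , i⁺≡ , o') = consecutive-suc (trans (cong toℕ (owner-≡ o')) i⁺≡)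

  project-link : ∀ {j j'} → owner j ≢ owner j' → Consecutive q j j' → Consecutive p (owner j) (owner j')
  project-link dj≢dj' (inj₁ j'≡) = project-succ dj≢dj' j'≡
  project-link dj≢dj' (inj₂ j≡) = consecutive-sym (project-succ (dj≢dj' ∘ sym) j≡)

  cycle-index-≤R : indexGraph (Consecutive p) consecutive-sym ≤R indexGraph (Consecutive q) consecutive-sym
  cycle-index-≤R =
    fibres-≤R consecutive-sym consecutive-sym ψ owner owner-ψ owner-zero fibre-walk lift-link project-link

module _ {n : ℕ} (Gs : Fin (suc n) → RGraph) where

  quot-root : ∀ {a} → IsRoot Gs a → quot Gs a ≡ inj₁ tt
  quot-root {j , _} refl with _≟V_ (graph (Gs j)) (rt (Gs j)) (rt (Gs j))
  ... | yes _ = refl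
  ... | no rt≢rt = ⊥-elim (rt≢rt refl)

  quot-root⁻¹ : ∀ {a} → quot Gs a ≡ inj₁ tt → IsRoot Gs a
  quot-root⁻¹ {j , y} a↦root with _≟V_ (graph (Gs j)) y (rt (Gs j))
  quot-root⁻¹ {j , y} _ | yes y≡rt = y≡rt
  quot-root⁻¹ {j , y} () | no _

  position : SV Gs → UV Gs
  position (inj₁ _) = F.zero , rt (Gs F.zero)
  position (inj₂ (j , y , _)) = j , y

  position-quot : ∀ {j y} → y ≢ rt (Gs j) → position (quot Gs (j , y)) ≡ (j , y)
  position-quot {j} {y} y≢rt with _≟V_ (graph (Gs j)) y (rt (Gs j))
  ... | yes y≡rt = ⊥-elim (y≢rt y≡rt)
  ... | no _ = refl

  -- Splitting on the decision y ≟ rt directly is ill-typed, since y≢rt depends on it.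
  quot-nonroot : ∀ {j y} (y≢rt : False (_≟V_ (graph (Gs j)) y (rt (Gs j)))) →
    quot Gs (j , y) ≡ inj₂ (j , y , y≢rt)
  quot-nonroot {j} {y} y≢rt =
    nonroot-η (quot Gs (j , y)) (toWitnessFalse y≢rt ∘ quot-root⁻¹) (position-quot (toWitnessFalse y≢rt))
    where
      nonroot-η : ∀ g → g ≢ inj₁ tt → position g ≡ (j , y) → g ≡ inj₂ (j , y , y≢rt)
      nonroot-η (inj₁ tt) g≢root _ = ⊥-elim (g≢root refl)
      nonroot-η (inj₂ (_ , _ , y≢rt′)) _ refl = cong (λ w → inj₂ (j , y , w)) (T-irrelevant y≢rt′ y≢rt)

  quot-section : ∀ g → Σ (UV Gs) λ a → quot Gs a ≡ g
  quot-section (inj₁ tt) = (F.zero , rt (Gs F.zero)) , quot-root refl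
  quot-section (inj₂ (j , y , y≢rt)) = (j , y) , quot-nonroot y≢rt

  quot-injective : ∀ {a b} → quot Gs a ≡ quot Gs b → ¬ IsRoot Gs a → a ≡ b
  quot-injective {j , y} {k , z} a↦b y≢rt
    with _≟V_ (graph (Gs j)) y (rt (Gs j)) | _≟V_ (graph (Gs k)) z (rt (Gs k))
  quot-injective _ y≢rt | yes y≡rt | _ = ⊥-elim (y≢rt y≡rt)
  quot-injective () _ | no _ | yes _
  quot-injective a↦b _ | no _ | no _ = cong (λ (k , z , _) → k , z) (inj₂-injective a↦b)

  roots-same-quot : ∀ {a b} → IsRoot Gs a → IsRoot Gs b → quot Gs a ≡ quot Gs b
  roots-same-quot ra rb = trans (quot-root ra) (sym (quot-root rb))

  quot-≡ : ∀ {a b} → quot Gs a ≡ quot Gs b → a ≡ b ⊎ (IsRoot Gs a × IsRoot Gs b)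
  quot-≡ {a} a↦b = case isRoot? Gs a of λ where
    (yes ra) → inj₂ (ra , quot-root⁻¹ (trans (sym a↦b) (quot-root ra)))
    (no ¬ra) → inj₁ (quot-injective a↦b ¬ra)

  linkE-quot : ∀ {L a b} → LinkE Gs L a b → StE Gs (quot Gs a) (quot Gs b) ⊎ (IsRoot Gs a × IsRoot Gs b)
  linkE-quot (inner {j} {x} {y} e) = inj₁ (j , x , y , e , refl , refl)
  linkE-quot (link _ _) = inj₂ (refl , refl)

module Stick {p q : ℕ}
  {LH : Fin (suc p) → Fin (suc p) → Set} {LH-sym : ∀ {i i'} → LH i i' → LH i' i}
  {LG : Fin (suc q) → Fin (suc q) → Set} {LG-sym : ∀ {j j'} → LG j j' → LG j' j}
  {Hs : Fin (suc p) → RGraph} {Gs : Fin (suc q) → RGraph}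
  (M : linked LH LH-sym Hs ≤R linked LG LG-sym Gs)
  (root-only : ∀ {a b} → Model.φ M a b → IsRoot Gs b → IsRoot Hs a)
  (root-reached : ∀ i → Σ (Fin (suc q)) λ j → Model.φ M (i , rt (Hs i)) (j , rt (Gs j)))
  where

  private
    φ : UV Hs → UV Gs → Set
    φ = Model.φ M

    LinkedG StickG : Graph
    LinkedG = graph (linked LG LG-sym Gs)
    StickG = graph (stickG Gs)

  data StickBag (u : SV Hs) (g : SV Gs) : Set where
    image : ∀ {a b} → φ a b → quot Hs a ≡ u → quot Gs b ≡ g → StickBag u g

  -- Anchoring root bags at roots makes them all share the hub inj₁ tt of the stick.
  anchor : ∀ a → Σ (UV Gs) λ b → φ a b × (IsRoot Hs a → IsRoot Gs b)
  anchor (i , x) with isRoot? Hs (i , x)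
  ... | yes refl = let (j , f) = root-reached i in (j , rt (Gs j)) , f , λ _ → refl
  ... | no ¬root = let (b , f) = proj₁ (Model.conn M (i , x)) in b , f , λ root → ⊥-elim (¬root root)

  anchor-quot : ∀ {a a'} → quot Hs a ≡ quot Hs a' →
    quot Gs (proj₁ (anchor a)) ≡ quot Gs (proj₁ (anchor a'))
  anchor-quot a↦a' with quot-≡ Hs a↦a'
  ... | inj₁ refl = refl
  ... | inj₂ (ra , ra') = roots-same-quot Gs (proj₂ (proj₂ (anchor _)) ra) (proj₂ (proj₂ (anchor _)) ra')

  push : ∀ {a u b b'} → quot Hs a ≡ u → Walk LinkedG (φ a) b b' →
    Walk StickG (StickBag u) (quot Gs b) (quot Gs b')
  push a↦u = mapʷ (quot Gs) (λ f → image f a↦u refl) λ e → case linkE-quot Gs e of λ where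
    (inj₁ e') → inj₁ e'
    (inj₂ (ra , rb)) → inj₂ (roots-same-quot Gs ra rb)

  conn : ∀ u → ConnectedOn StickG (StickBag u)
  conn u = connectedOn-hub (quot Gs (proj₁ (anchor a₀))) (image (proj₁ (proj₂ (anchor a₀))) a₀↦u refl)
    λ { _ (image {a} {b} f a↦u refl) →
          subst (Walk StickG (StickBag u) (quot Gs b)) (anchor-quot (trans a↦u (sym a₀↦u)))
            (push a↦u (proj₂ (Model.conn M a) b _ f (proj₁ (proj₂ (anchor a))))) }
    where
      a₀ = proj₁ (quot-section Hs u)
      a₀↦u = proj₂ (quot-section Hs u)

  cover : ∀ g → Σ (SV Hs) λ u → StickBag u g
  cover g = let (b , b↦g) = quot-section Gs g ; (a , f) = Model.cover M b in quot Hs a , image f refl b↦g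

  disj : ∀ u v g → StickBag u g → StickBag v g → u ≡ v
  disj u v g (image {a} {b} f a↦u b↦g) (image {a'} {b'} f' a'↦v b'↦g) with quot-≡ Gs (trans b↦g (sym b'↦g))
  ... | inj₁ refl = trans (sym a↦u) (trans (cong (quot Hs) (Model.disj M a a' b f f')) a'↦v)
  ... | inj₂ (rb , rb') = trans (sym a↦u) (trans (roots-same-quot Hs (root-only f rb) (root-only f' rb')) a'↦v)

  preimage-in-bag : ∀ {u g b} → StickBag u g → quot Gs b ≡ g → Σ (UV Hs) λ a → quot Hs a ≡ u × φ a b
  preimage-in-bag (image {a} f a↦u b'↦g) b↦g with quot-≡ Gs (trans b'↦g (sym b↦g))
  ... | inj₁ refl = a , a↦u , f
  ... | inj₂ (rb' , rb) = let (a* , f*) = Model.cover M _ in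
    a* , trans (roots-same-quot Hs (root-only f* rb) (root-only f rb')) a↦u , f*

  preimages-distinct : ∀ {u v a a'} → u ≢ v → quot Hs a ≡ u → quot Hs a' ≡ v → a ≢ a'
  preimages-distinct u≢v a↦u a'↦v refl = u≢v (trans (sym a↦u) a'↦v)

  lift-edge : ∀ {u v} → u ≢ v → StE Hs u v →
    Σ (SV Gs) λ g → Σ (SV Gs) λ g' → StickBag u g × StickBag v g' × StE Gs g g'
  lift-edge u≢v (i , x , y , e , x↦u , y↦v)
    with Equivalence.to (Model.adj M (i , x) (i , y) (preimages-distinct u≢v x↦u y↦v)) (inner e)
  ... | b , b' , f , f' , e' with linkE-quot Gs e'
  ...   | inj₁ e'' = quot Gs b , quot Gs b' , image f x↦u refl , image f' y↦v refl , e''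
  ...   | inj₂ (rb , rb') =
    ⊥-elim (u≢v (trans (sym x↦u) (trans (roots-same-quot Hs (root-only f rb) (root-only f' rb')) y↦v)))

  project-edge : ∀ {u v g g'} → u ≢ v → StickBag u g → StickBag v g' → StE Gs g g' → StE Hs u v
  project-edge u≢v s s' (j , y , y' , e , y↦g , y'↦g')
    with preimage-in-bag s y↦g | preimage-in-bag s' y'↦g'
  ... | a , a↦u , f | a' , a'↦v , f'
    with linkE-quot Hs (Equivalence.from (Model.adj M a a' (preimages-distinct u≢v a↦u a'↦v))
                                          (_ , _ , f , f' , inner e))
  ...   | inj₁ e' = subst₂ (StE Hs) a↦u a'↦v e'
  ...   | inj₂ (ra , ra') = ⊥-elim (u≢v (trans (sym a↦u) (trans (roots-same-quot Hs ra ra') a'↦v)))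

  stick-≤R : stickG Hs ≤R stickG Gs
  stick-≤R = record
    { φ = StickBag
    ; conn = conn
    ; cover = cover
    ; disj = disj
    ; adj = λ u v u≢v → mk⇔ (lift-edge u≢v) (λ (_ , _ , s , s' , e) → project-edge u≢v s s' e)
    ; root = image (Model.root M) (quot-root Hs refl) (quot-root Gs refl)
    }

linkE⇔cycE : ∀ {n} {Gs : Fin (suc n) → RGraph} {a b} → LinkE Gs (Consecutive n) a b ⇔ CycE Gs a b
linkE⇔cycE = mk⇔ (λ { (inner e) → inner e ; (link i≢j c) → link refl refl i≢j c })
                 (λ { (inner e) → inner e ; (link refl refl i≢j c) → link i≢j c })

linkE⇔cliE : ∀ {n} {Gs : Fin (suc n) → RGraph} {a b} → LinkE Gs Complete a b ⇔ CliE Gs a b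
linkE⇔cliE = mk⇔ (λ { (inner e) → inner e ; (link i≢j _) → link refl refl i≢j })
                 (λ { (inner e) → inner e ; (link refl refl i≢j) → link i≢j tt })

lemma10 : ∀ {p q} (Hs : Fin (suc p) → RGraph) (Gs : Fin (suc q) → RGraph) →
    (∀ i → InC (Hs i)) → (∀ j → InC (Gs j)) →
    Hs ≤⋆ Gs →
    (cycleG Hs ≤R cycleG Gs) × (cliqueG Hs ≤R cliqueG Gs) × (stickG Hs ≤R stickG Gs)
lemma10 Hs Gs _ Gs∈𝒞 (ψ , ψ-strict , Ms) =
  ≤R-resp-edge⇔ cycle-linked linkE⇔cycE linkE⇔cycE ,
  ≤R-resp-edge⇔ Clique.linked-≤R linkE⇔cliE linkE⇔cliE ,
  Stick.stick-≤R Clique.linked-≤R Clique.root-only (λ i → ψ i , Clique.root-bag (owner-ψ i))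
  where
    open Owner ψ ψ-strict

    Gs-conn : ∀ j → Connected (graph (Gs j))
    Gs-conn j = proj₁ (proj₂ (Gs∈𝒞 j))

    cycle-linked : linked (Consecutive _) consecutive-sym Hs ≤R linked (Consecutive _) consecutive-sym Gs
    cycle-linked = Lift.linked-≤R consecutive-sym consecutive-sym cycle-index-≤R {Hs} {Gs} ψ owner-ψ Ms Gs-conn
    module Clique = Lift _ _ (clique-index-≤R ψ owner owner-ψ owner-zero) {Hs} {Gs} ψ owner-ψ Ms Gs-conn
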